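{- Let $G$ be a finite simple graph and $k$ a positive integer. Suppose the vertex set of $G$ can be partitioned into $k$ sets $S_1,\dots,S_k$ such that each induced subgraph $G[S_i]$ is complete, $|S_i| > k$ for each $i$, and for all $i\ne j$ each vertex of $S_i$ is adjacent to at most one vertex of $S_j$. Then $\gamma_{\mathrm{aut}}(G) = k$.
   Context: For a finite simple graph $G=(V,E)$: two dominating sets $S,S'$ are adjacent if there are $v\in S$, $v'\in S'$ with $vv'\in E$ and $S'=(S\setminus\{v\})\cup\{v'\}$. A collection $\mathcal{F}$ of subsets of $V$ is an autonomously dominating family if: (1) every member is a dominating set; (2) for each $S\in\mathcal{F}$ and each $v\in V\setminus S$ there is $S'\in\mathcal{F}$ adjacent to $S$ with $v\in S'$; (3) for each $S\in\mathcal{F}$, every dominating set adjacent to $S$ belongs to $\mathcal{F}$. An autonomous dominating set is a member of some autonomously dominating family; $\gamma_{\mathrm{aut}}(G)$ is the least size of one. -}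

module Defs where

open import Data.Nat using (ℕ; _≤_; _<_)
open import Data.Bool using (Bool; true; false)
open import Data.Fin using (Fin)
open import Data.Fin.Properties using (_≟_)
open import Data.Fin.Subset using (Subset; _∈_; _∉_; _∪_; _-_; ⁅_⁆; ∣_∣)
open import Data.Vec using (tabulate)
open import Data.Product using (Σ; ∃; _×_; _,_)
open import Data.Sum using (_⊎_)
open import Relation.Nullary using (¬_)
open import Relation.Nullary.Decidable using (isYes)
open import Relation.Binary.PropositionalEquality using (_≡_; _≢_)
open import Level using (suc; zero)

record Graph (n : ℕ) : Set where
  field
    adj   : Fin n → Fin n → Bool
    sym   : ∀ u v → adj u v ≡ adj v u
    irrefl : ∀ v → adj v v ≡ false

open Graph public

module _ {n : ℕ} (G : Graph n) where

  Adj : Fin n → Fin n → Set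
  Adj u v = adj G u v ≡ true

  Dominating : Subset n → Set
  Dominating S = ∀ v → v ∈ S ⊎ (∃ λ u → u ∈ S × Adj u v)

  AdjSets : Subset n → Subset n → Set
  AdjSets S S' = ∃ λ v → ∃ λ v' →
    v ∈ S × v' ∈ S' × Adj v v' × S' ≡ (S - v) ∪ ⁅ v' ⁆

  record IsAutDomFamily (F : Subset n → Set) : Set where
    field
      dom    : ∀ S → F S → Dominating S
      reach  : ∀ S → F S → ∀ v → v ∉ S →
               ∃ λ S' → F S' × AdjSets S S' × v ∈ S'
      closed : ∀ S → F S → ∀ S' → Dominating S' → AdjSets S S' → F S'

  AutDom : Subset n → Set₁
  AutDom S = Σ (Subset n → Set) λ F → IsAutDomFamily F × F S

  γaut≡ : ℕ → Set₁
  γaut≡ m = (∃ λ S → AutDom S × ∣ S ∣ ≡ m) × (∀ S → AutDom S → m ≤ ∣ S ∣)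

part : {n k : ℕ} → (Fin n → Fin k) → Fin k → Subset n
part p i = tabulate (λ v → isYes (p v ≟ i))

-- A dominating set D has at least k vertices: if it meets every clique S_i this is clear, and
-- if it misses some S_j then the vertices of S_j have pairwise distinct dominators (a vertex
-- outside S_j has at most one neighbour in it), so |D| ≥ |S_j| > k. Hence the dominating sets
-- of size k are exactly the transversals of the cliques. They form an autonomously dominating
-- family: a dominating set adjacent to one of them has size at most k, hence exactly k, and a
-- vertex v is brought in by exchanging it for the representative of its own clique.

module Submission where

open import Defs hiding (sym)
open import Data.Nat using (ℕ; suc; _+_; _≤_; _<_; z≤n; s≤s)
open import Data.Nat.Properties
  using (module ≤-Reasoning; ≤-refl; ≤-trans; ≤-reflexive; <⇒≤; ≤-antisym; <-≤-trans; ≤-<-trans;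
         <-irrefl; m≤n⇒m≤1+n; +-suc; +-comm; +-monoʳ-≤)
open import Data.Bool.Properties using (T-≡)
open import Data.Fin using (Fin)
open import Data.Fin.Properties using (_≟_; any?; all?; ¬∀⟶∃¬)
open import Data.Fin.Subset
  using (Subset; _∈_; _∉_; _⊆_; _⊂_; _∪_; _─_; _-_; ⁅_⁆; ∣_∣; ⊤; inside; outside; Nonempty; Empty)
open import Data.Fin.Subset.Properties
  using (_∈?_; nonempty?; Empty-unique; ∣⊥∣≡0; ∣⊤∣≡n; ∣⁅x⁆∣≡1; ∈⊤; x∈⁅x⁆; x∈p∪q⁺;
         p⊆q⇒∣p∣≤∣q∣; p─q⊆p; x∈p∧x≢y⇒x∈p-y; x∈p⇒p-x⊂p; x∈p⇒∣p-x∣<∣p∣)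
open import Data.Fin.Subset.Induction using (Acc; acc; ⊂-wellFounded)
open import Data.Vec using ([]; _∷_; tabulate; here; there)
open import Data.Vec.Properties using ([]=⇒lookup; lookup⇒[]=; lookup∘tabulate)
open import Data.Product using (∃; _×_; _,_; proj₁; proj₂)
open import Data.Sum using (inj₁; inj₂; [_,_]′)
open import Level using (0ℓ)
open import Function using (_∘_; const; Equivalence)
open import Relation.Nullary using (¬_; yes; no; contradiction)
open import Relation.Nullary.Decidable using (isYes; isYes≗does; dec-true; toWitness; _×-dec_)
open import Relation.Unary using (Pred; Decidable)
open import Relation.Binary.PropositionalEquality using (_≡_; _≢_; refl; sym; trans; cong; subst)

private
  variable
    n : ℕ

x∈q⇒x∉p─q : ∀ {x : Fin n} (p q : Subset n) → x ∈ q → x ∉ p ─ q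
x∈q⇒x∉p─q (outside ∷ p) (inside ∷ q) here ()
x∈q⇒x∉p─q (inside  ∷ p) (inside ∷ q) here ()
x∈q⇒x∉p─q (_ ∷ p) (_ ∷ q) (there x∈q) (there x∈p─q) = x∈q⇒x∉p─q p q x∈q x∈p─q

x∉p-x : ∀ (p : Subset n) (x : Fin n) → x ∉ p - x
x∉p-x p x = x∈q⇒x∉p─q p ⁅ x ⁆ (x∈⁅x⁆ x)

∣p∪q∣≤∣p∣+∣q∣ : ∀ (p q : Subset n) → ∣ p ∪ q ∣ ≤ ∣ p ∣ + ∣ q ∣
∣p∪q∣≤∣p∣+∣q∣ []            []            = z≤n
∣p∪q∣≤∣p∣+∣q∣ (outside ∷ p) (outside ∷ q) = ∣p∪q∣≤∣p∣+∣q∣ p q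
∣p∪q∣≤∣p∣+∣q∣ (outside ∷ p) (inside  ∷ q) =
  ≤-trans (s≤s (∣p∪q∣≤∣p∣+∣q∣ p q)) (≤-reflexive (sym (+-suc ∣ p ∣ ∣ q ∣)))
∣p∪q∣≤∣p∣+∣q∣ (inside  ∷ p) (outside ∷ q) = s≤s (∣p∪q∣≤∣p∣+∣q∣ p q)
∣p∪q∣≤∣p∣+∣q∣ (inside  ∷ p) (inside  ∷ q) =
  s≤s (≤-trans (∣p∪q∣≤∣p∣+∣q∣ p q) (+-monoʳ-≤ ∣ p ∣ (m≤n⇒m≤1+n ≤-refl)))

∣p∪⁅x⁆∣≤1+∣p∣ : ∀ (p : Subset n) x → ∣ p ∪ ⁅ x ⁆ ∣ ≤ suc ∣ p ∣
∣p∪⁅x⁆∣≤1+∣p∣ p x = begin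
  ∣ p ∪ ⁅ x ⁆ ∣       ≤⟨ ∣p∪q∣≤∣p∣+∣q∣ p ⁅ x ⁆ ⟩
  ∣ p ∣ + ∣ ⁅ x ⁆ ∣   ≡⟨ cong (∣ p ∣ +_) (∣⁅x⁆∣≡1 x) ⟩
  ∣ p ∣ + 1           ≡⟨ +-comm ∣ p ∣ 1 ⟩
  suc ∣ p ∣           ∎
  where open ≤-Reasoning

∣p∣≤1+∣p-x∣ : ∀ (p : Subset n) x → ∣ p ∣ ≤ suc ∣ p - x ∣
∣p∣≤1+∣p-x∣ p x = ≤-trans (p⊆q⇒∣p∣≤∣q∣ p⊆p-x∪⁅x⁆) (∣p∪⁅x⁆∣≤1+∣p∣ (p - x) x)
  where
  p⊆p-x∪⁅x⁆ : p ⊆ (p - x) ∪ ⁅ x ⁆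
  p⊆p-x∪⁅x⁆ {y} y∈p with y ≟ x
  ... | yes refl = x∈p∪q⁺ (inj₂ (x∈⁅x⁆ x))
  ... | no y≢x   = x∈p∪q⁺ (inj₁ (x∈p∧x≢y⇒x∈p-y y∈p y≢x))

∣p-x∪⁅y⁆∣≤∣p∣ : ∀ {p : Subset n} {x} y → x ∈ p → ∣ (p - x) ∪ ⁅ y ⁆ ∣ ≤ ∣ p ∣
∣p-x∪⁅y⁆∣≤∣p∣ {p = p} {x} y x∈p = ≤-trans (∣p∪⁅x⁆∣≤1+∣p∣ (p - x) y) (x∈p⇒∣p-x∣<∣p∣ x∈p)

Empty⇒∣p∣≡0 : ∀ {p : Subset n} → Empty p → ∣ p ∣ ≡ 0
Empty⇒∣p∣≡0 {n} p-empty = trans (cong ∣_∣ (Empty-unique p-empty)) (∣⊥∣≡0 n)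

injectiveOn⇒∣p∣≤∣q∣ : ∀ {m n} {A : Subset m} (B : Subset n) (f : Fin m → Fin n) →
  (∀ {x} → x ∈ A → f x ∈ B) →
  (∀ {x y} → x ∈ A → y ∈ A → f x ≡ f y → x ≡ y) →
  ∣ A ∣ ≤ ∣ B ∣
injectiveOn⇒∣p∣≤∣q∣ {m} {n} {A} = go (⊂-wellFounded A)
  where
  go : ∀ {A : Subset m} → Acc _⊂_ A → ∀ (B : Subset n) f →
       (∀ {x} → x ∈ A → f x ∈ B) → (∀ {x y} → x ∈ A → y ∈ A → f x ≡ f y → x ≡ y) →
       ∣ A ∣ ≤ ∣ B ∣
  go {A = A} (acc rec) B f into inj with nonempty? A
  ... | no A-empty = ≤-trans (≤-reflexive (Empty⇒∣p∣≡0 A-empty)) z≤n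
  ... | yes (x , x∈A) = begin
    ∣ A ∣             ≤⟨ ∣p∣≤1+∣p-x∣ A x ⟩
    suc ∣ A - x ∣     ≤⟨ s≤s (go (rec (x∈p⇒p-x⊂p x∈A)) (B - f x) f into′ inj′) ⟩
    suc ∣ B - f x ∣   ≤⟨ x∈p⇒∣p-x∣<∣p∣ (into x∈A) ⟩
    ∣ B ∣             ∎
    where
    open ≤-Reasoning
    ∈A : ∀ {y} → y ∈ A - x → y ∈ A
    ∈A = p─q⊆p A ⁅ x ⁆
    into′ : ∀ {y} → y ∈ A - x → f y ∈ B - f x
    into′ {y} y∈A-x = x∈p∧x≢y⇒x∈p-y (into (∈A y∈A-x)) λ fy≡fx →
      x∉p-x A x (subst (_∈ A - x) (inj (∈A y∈A-x) x∈A fy≡fx) y∈A-x)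
    inj′ : ∀ {y z} → y ∈ A - x → z ∈ A - x → f y ≡ f z → y ≡ z
    inj′ y∈ z∈ = inj (∈A y∈) (∈A z∈)

0<∣p∣⇒Nonempty : ∀ {p : Subset n} → 0 < ∣ p ∣ → Nonempty p
0<∣p∣⇒Nonempty {n} {p} 0<∣p∣ with nonempty? p
... | yes p-nonempty = p-nonempty
... | no p-empty =
  contradiction (subst (0 <_) (Empty⇒∣p∣≡0 p-empty) 0<∣p∣) λ ()

module _ {P : Pred (Fin n) 0ℓ} (P? : Decidable P) {x : Fin n} where

  ∈-tabulate-isYes⁻ : x ∈ tabulate (isYes ∘ P?) → P x
  ∈-tabulate-isYes⁻ x∈ =
    toWitness (Equivalence.from T-≡ (trans (sym (lookup∘tabulate (isYes ∘ P?) x)) ([]=⇒lookup x∈)))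

  ∈-tabulate-isYes⁺ : P x → x ∈ tabulate (isYes ∘ P?)
  ∈-tabulate-isYes⁺ px =
    lookup⇒[]= x _ (trans (lookup∘tabulate (isYes ∘ P?) x) (trans (isYes≗does (P? x)) (dec-true (P? x) px)))

module _ (G : Graph n) {D : Subset n} (D-dominating : Dominating G D) where

  dominator : Fin n → Fin n
  dominator w = [ const w , proj₁ ]′ (D-dominating w)

  dominator-dominates : ∀ {w} → w ∉ D → dominator w ∈ D × Adj G (dominator w) w
  dominator-dominates {w} w∉D with D-dominating w
  ... | inj₁ w∈D             = contradiction w∈D w∉D
  ... | inj₂ (_ , u∈D , adj) = u∈D , adj

module _ {k} (G : Graph n) (p : Fin n → Fin k) where

  Meets : Subset n → Fin k → Set
  Meets S i = ∃ λ y → y ∈ S × p y ≡ i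

  MeetsAll : Subset n → Set
  MeetsAll S = ∀ i → Meets S i

  meets? : ∀ S → Decidable (Meets S)
  meets? S i = any? λ y → (y ∈? S) ×-dec (p y ≟ i)

  meetsAll⇒k≤∣S∣ : ∀ {S} → MeetsAll S → k ≤ ∣ S ∣
  meetsAll⇒k≤∣S∣ {S} meetsAll = begin
    k           ≡⟨ sym (∣⊤∣≡n k) ⟩
    ∣ ⊤ {k} ∣   ≤⟨ injectiveOn⇒∣p∣≤∣q∣ S (proj₁ ∘ meetsAll) (λ {i} _ → proj₁ (proj₂ (meetsAll i))) inj ⟩
    ∣ S ∣       ∎
    where
    open ≤-Reasoning
    inj : ∀ {i j} → i ∈ ⊤ → j ∈ ⊤ → proj₁ (meetsAll i) ≡ proj₁ (meetsAll j) → i ≡ j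
    inj {i} {j} _ _ eq = trans (sym (proj₂ (proj₂ (meetsAll i))))
                               (trans (cong p eq) (proj₂ (proj₂ (meetsAll j))))

  meetsAll-swap : ∀ {S u v} → MeetsAll S → u ∈ S → p u ≡ p v → MeetsAll ((S - u) ∪ ⁅ v ⁆)
  meetsAll-swap {S} {u} {v} meetsAll u∈S pu≡pv i with meetsAll i
  ... | y , y∈S , py≡i with y ≟ u
  ...   | yes refl = v , x∈p∪q⁺ (inj₂ (x∈⁅x⁆ v)) , trans (sym pu≡pv) py≡i
  ...   | no y≢u   = y , x∈p∪q⁺ (inj₁ (x∈p∧x≢y⇒x∈p-y y∈S y≢u)) , py≡i

  transversal : (∀ i → Nonempty (part p i)) → ∃ λ T → MeetsAll T × ∣ T ∣ ≤ k
  transversal nonempty = T , meetsAll , ∣T∣≤k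
    where
    rep : Fin k → Fin n
    rep = proj₁ ∘ nonempty
    p∘rep : ∀ i → p (rep i) ≡ i
    p∘rep i = ∈-tabulate-isYes⁻ (λ v → p v ≟ i) (proj₂ (nonempty i))
    isRep? : Decidable λ x → x ≡ rep (p x)
    isRep? x = x ≟ rep (p x)
    T : Subset n
    T = tabulate (isYes ∘ isRep?)
    meetsAll : MeetsAll T
    meetsAll i = rep i , ∈-tabulate-isYes⁺ isRep? (cong rep (sym (p∘rep i))) , p∘rep i
    ∣T∣≤k : ∣ T ∣ ≤ k
    ∣T∣≤k = ≤-trans (injectiveOn⇒∣p∣≤∣q∣ (⊤ {k}) p (const ∈⊤) inj) (≤-reflexive (∣⊤∣≡n k))
      where
      inj : ∀ {x y} → x ∈ T → y ∈ T → p x ≡ p y → x ≡ y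
      inj x∈T y∈T px≡py = trans (∈-tabulate-isYes⁻ isRep? x∈T)
        (trans (cong rep px≡py) (sym (∈-tabulate-isYes⁻ isRep? y∈T)))

  module _ (cliques : ∀ u v → p u ≡ p v → u ≢ v → Adj G u v) where

    meetsAll⇒Dominating : ∀ {S} → MeetsAll S → Dominating G S
    meetsAll⇒Dominating meetsAll v with meetsAll (p v)
    ... | y , y∈S , py≡pv with y ≟ v
    ...   | yes refl = inj₁ y∈S
    ...   | no y≢v   = inj₂ (y , y∈S , cliques y v py≡pv y≢v)

  module _ (oneNeighbour : ∀ v u w → p v ≢ p u → p u ≡ p w → Adj G v u → Adj G v w → u ≡ w) where

    missing⇒∣part∣≤∣D∣ : ∀ {D j} → Dominating G D → ¬ Meets D j → ∣ part p j ∣ ≤ ∣ D ∣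
    missing⇒∣part∣≤∣D∣ {D} {j} D-dominating misses =
      injectiveOn⇒∣p∣≤∣q∣ D dom (proj₁ ∘ dominates) inj
      where
      dom : Fin n → Fin n
      dom = dominator G D-dominating
      inClass : ∀ {w} → w ∈ part p j → p w ≡ j
      inClass = ∈-tabulate-isYes⁻ (λ v → p v ≟ j)
      dominates : ∀ {w} → w ∈ part p j → dom w ∈ D × Adj G (dom w) w
      dominates w∈j = dominator-dominates G D-dominating λ w∈D → misses (_ , w∈D , inClass w∈j)
      inj : ∀ {x y} → x ∈ part p j → y ∈ part p j → dom x ≡ dom y → x ≡ y
      inj {x} {y} x∈j y∈j same = oneNeighbour (dom x) x y
        (λ eq → misses (dom x , proj₁ (dominates x∈j) , trans eq (inClass x∈j)))
        (trans (inClass x∈j) (sym (inClass y∈j)))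
        (proj₂ (dominates x∈j))
        (subst (λ u → Adj G u y) (sym same) (proj₂ (dominates y∈j)))

    module _ (large : ∀ i → k < ∣ part p i ∣) where

      part-nonempty : ∀ i → Nonempty (part p i)
      part-nonempty i = 0<∣p∣⇒Nonempty (≤-<-trans z≤n (large i))

      missing⇒k<∣D∣ : ∀ {D j} → Dominating G D → ¬ Meets D j → k < ∣ D ∣
      missing⇒k<∣D∣ {j = j} D-dominating misses = <-≤-trans (large j) (missing⇒∣part∣≤∣D∣ D-dominating misses)

      dominating⇒k≤∣D∣ : ∀ {D} → Dominating G D → k ≤ ∣ D ∣
      dominating⇒k≤∣D∣ {D} D-dominating with all? (meets? D)
      ... | yes meetsAll = meetsAll⇒k≤∣S∣ meetsAll
      ... | no ¬meetsAll with _ , misses ← ¬∀⟶∃¬ k (Meets D) (meets? D) ¬meetsAll =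
        <⇒≤ (missing⇒k<∣D∣ D-dominating misses)

      ∣D∣≡k⇒meetsAll : ∀ {D} → Dominating G D → ∣ D ∣ ≡ k → MeetsAll D
      ∣D∣≡k⇒meetsAll {D} D-dominating ∣D∣≡k j with meets? D j
      ... | yes meets = meets
      ... | no misses = contradiction (subst (k <_) ∣D∣≡k (missing⇒k<∣D∣ D-dominating misses)) (<-irrefl refl)

      module _ (cliques : ∀ u v → p u ≡ p v → u ≢ v → Adj G u v) where

        MinimumDominating : Subset n → Set
        MinimumDominating S = Dominating G S × ∣ S ∣ ≡ k

        minimumDominating-isAutDomFamily : IsAutDomFamily G MinimumDominating
        minimumDominating-isAutDomFamily = record { dom = λ _ → proj₁ ; reach = reach ; closed = closed }
          where
          closed : ∀ S → MinimumDominating S → ∀ S′ → Dominating G S′ → AdjSets G S S′ → MinimumDominating S′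
          closed S (_ , ∣S∣≡k) S′ S′-dominating (u , v , u∈S , _ , _ , refl) =
            S′-dominating , ≤-antisym (≤-trans (∣p-x∪⁅y⁆∣≤∣p∣ v u∈S) (≤-reflexive ∣S∣≡k)) (dominating⇒k≤∣D∣ S′-dominating)
          reach : ∀ S → MinimumDominating S → ∀ v → v ∉ S →
                  ∃ λ S′ → MinimumDominating S′ × AdjSets G S S′ × v ∈ S′
          reach S (S-dominating , ∣S∣≡k) v v∉S with ∣D∣≡k⇒meetsAll S-dominating ∣S∣≡k (p v)
          ... | u , u∈S , pu≡pv = S′ , closed S (S-dominating , ∣S∣≡k) S′ S′-dominating S-S′ , S-S′ , v∈S′
            where
            S′ : Subset n
            S′ = (S - u) ∪ ⁅ v ⁆
            v∈S′ : v ∈ S′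
            v∈S′ = x∈p∪q⁺ (inj₂ (x∈⁅x⁆ v))
            S-S′ : AdjSets G S S′
            S-S′ = u , v , u∈S , v∈S′ , cliques u v pu≡pv (λ { refl → v∉S u∈S }) , refl
            S′-dominating : Dominating G S′
            S′-dominating = meetsAll⇒Dominating cliques
              (meetsAll-swap (∣D∣≡k⇒meetsAll S-dominating ∣S∣≡k) u∈S pu≡pv)

        ∃minimumDominating : ∃ MinimumDominating
        ∃minimumDominating with T , T-meetsAll , ∣T∣≤k ← transversal part-nonempty =
          T , T-dominating , ≤-antisym ∣T∣≤k (dominating⇒k≤∣D∣ T-dominating)
          where
          T-dominating : Dominating G T
          T-dominating = meetsAll⇒Dominating cliques T-meetsAll

        γaut≡k : γaut≡ G k
        γaut≡k with T , T-minimum ← ∃minimumDominating =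
          (T , (MinimumDominating , minimumDominating-isAutDomFamily , T-minimum) , proj₂ T-minimum) ,
          λ S (_ , family , S∈family) → dominating⇒k≤∣D∣ (IsAutDomFamily.dom family S S∈family)

mainTheorem11 : (n k : ℕ) → (G : Graph n) → 1 ≤ k →
    (p : Fin n → Fin k) →
    (∀ u v → p u ≡ p v → u ≢ v → Adj G u v) →
    (∀ i → k < ∣ part p i ∣) →
    (∀ v u w → p v ≢ p u → p u ≡ p w → Adj G v u → Adj G v w → u ≡ w) →
    γaut≡ G k
mainTheorem11 n k G _ p cliques large oneNeighbour = γaut≡k G p oneNeighbour large cliques
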